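{- Let $\mathcal{Q}$ be a finite thick generalised quadrangle of order $(s,t)$ and let $\theta$ be an automorphism of $\mathcal{Q}$ of order $2$ or $3$ that fixes no point of $\mathcal{Q}$. If $s$ and $t$ are not coprime, then $\theta$ fixes a line of $\mathcal{Q}$.
   Context: A finite generalised quadrangle is a finite point-line geometry in which every two points lie on at most one line and, for every point $p$ and line $L$ not through $p$, there is a unique point on $L$ collinear with $p$. It is thick of order $(s,t)$ if every line has exactly $s+1\ge 3$ points and every point lies on exactly $t+1\ge 3$ lines. An automorphism is a permutation of points and lines preserving incidence. -}

module Defs where

open import Data.Nat using (ℕ; zero; suc; _+_; _≤_)
open import Data.Fin using (Fin)
open import Data.Product using (Σ; ∃; _×_; _,_)
open import Data.Sum using (_⊎_)
open import Relation.Nullary using (¬_; Dec; yes; no)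
open import Relation.Binary.PropositionalEquality using (_≡_)
open import Function.Bundles using (_↔_; Inverse)

count : ∀ {n} {P : Fin n → Set} → ((i : Fin n) → Dec (P i)) → ℕ
count {zero} d = 0
count {suc n} d with d Fin.zero
... | yes _ = suc (count {n} (λ i → d (Fin.suc i)))
... | no  _ = count {n} (λ i → d (Fin.suc i))

record Geometry : Set₁ where
  field
    np nl : ℕ
    _I_   : Fin np → Fin nl → Set
    I?    : (p : Fin np) (L : Fin nl) → Dec (p I L)

module _ (G : Geometry) where
  open Geometry G

  Collinear : Fin np → Fin np → Set
  Collinear p q = Σ (Fin nl) λ L → (p I L) × (q I L)

  record IsThickGQ (s t : ℕ) : Set where
    field
      s≥2 : 2 ≤ s
      t≥2 : 2 ≤ t
      line-size  : (L : Fin nl) → count (λ p → I? p L) ≡ suc s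
      point-deg  : (p : Fin np) → count (λ L → I? p L) ≡ suc t
      at-most-one-line : (p q : Fin np) → ¬ p ≡ q → (L M : Fin nl) →
                         p I L → q I L → p I M → q I M → L ≡ M
      gq-axiom : (p : Fin np) (L : Fin nl) → ¬ p I L →
                 Σ (Fin np) λ q → (q I L) × Collinear p q ×
                   ((q' : Fin np) → q' I L → Collinear p q' → q' ≡ q)

  record Automorphism : Set where
    field
      onPoints : Fin np ↔ Fin np
      onLines  : Fin nl ↔ Fin nl
    pt : Fin np → Fin np
    pt = Inverse.to onPoints
    ln : Fin nl → Fin nl
    ln = Inverse.to onLines
    field
      preserves : (p : Fin np) (L : Fin nl) → (p I L) → (pt p I ln L)
      reflects  : (p : Fin np) (L : Fin nl) → (pt p I ln L) → (p I L)

  open Automorphism public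

  iter : ∀ {A : Set} → ℕ → (A → A) → A → A
  iter zero f x = x
  iter (suc k) f x = f (iter k f x)

  PowIsId : Automorphism → ℕ → Set
  PowIsId θ k = ((p : Fin np) → iter k (pt θ) p ≡ p) ×
                ((L : Fin nl) → iter k (ln θ) L ≡ L)

  HasOrder : Automorphism → ℕ → Set
  HasOrder θ k = PowIsId θ k ×
                 ((j : ℕ) → 1 ≤ j → suc j ≤ k → ¬ PowIsId θ j)

-- Suppose θ fixes no line. Then no point x is collinear with θ x: a line L through x and θ x
-- also contains θ² x (for order 2 since θ² x = x; for order 3 since otherwise θ² x would be
-- collinear with the two points x and θ x of L), so L and θ L share two points and coincide.
-- Let p be a prime dividing s and t. Every point is on t + 1 ≡ 1 lines and every line has
-- s + 1 ≡ 1 points (mod p), so the collinearity matrix C (with C x x = 1) satisfies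
-- C J ≡ J C ≡ C² ≡ J² ≡ J; in particular the number of points is ≡ 1. The non-collinearity
-- matrix O = J - C therefore has O² ≡ 0, and so has Y x y = O (θ x) y, because θ preserves
-- collinearity. A square-zero matrix over ℤ/p has trace 0, by tr(Y)ᵖ ≡ tr(Yᵖ), which follows
-- from grouping the words of length p into rotation orbits of size p. But Y x x = 1 for every
-- x, so tr Y is the number of points.
module Submission where

open import Level using (0ℓ)
open import Data.Nat.Base using (ℕ; zero; suc; NonZero; s≤s; z≤n)
open import Data.Nat.Properties using (≤-trans)
open import Data.Nat.Divisibility using (_∣_)
open import Data.Nat.Primality using (Prime)
open import Data.Nat.Coprimality using (Coprime)
open import Data.Fin.Base using (Fin; zero; suc)
open import Data.Fin.Properties using (any?; _≟_)
open import Data.Product.Base using (Σ; ∃; _×_; _,_; proj₁)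
open import Data.Sum.Base using (_⊎_)
open import Data.Empty using (⊥-elim)
open import Relation.Nullary using (¬_; yes; no)
open import Relation.Binary.PropositionalEquality as ≡ using (_≡_)
open import Algebra.Bundles using (CommutativeSemiring)
open import Defs

module Modulo (p : ℕ) .{{_ : NonZero p}} where

  open import Data.Nat
  open import Data.Nat.Properties
  open import Data.Nat.DivMod
  open import Data.Nat.Divisibility using (m%n≡0⇒n∣m; n∣m⇒m%n≡0)
  open import Algebra.Structures using (IsCommutativeMonoid)
  open import Algebra.Structures.Biased using (IsCommutativeSemiringˡ)
  open import Relation.Binary.Structures using (IsEquivalence)
  open import Relation.Binary.Bundles using (Setoid)
  import Relation.Binary.Reasoning.Setoid as SetoidReasoning
  open ≡ using (refl; sym; trans; cong; cong₂; module ≡-Reasoning)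

  -- A record rather than a definition, so that type inference never has to invert _%_.
  infix 4 _≈_
  record _≈_ (m n : ℕ) : Set where
    constructor congruent
    field
      %-≡ : m % p ≡ n % p

  open _≈_ public

  ≡⇒≈ : ∀ {m n} → m ≡ n → m ≈ n
  ≡⇒≈ m≡n = congruent (cong (_% p) m≡n)

  ≈-isEquivalence : IsEquivalence _≈_
  ≈-isEquivalence = record
    { refl = congruent refl
    ; sym = λ m≈n → congruent (sym (%-≡ m≈n))
    ; trans = λ m≈n n≈o → congruent (trans (%-≡ m≈n) (%-≡ n≈o))
    }

  open IsEquivalence ≈-isEquivalence public
    using () renaming (refl to ≈-refl; sym to ≈-sym; trans to ≈-trans)

  setoid : Setoid 0ℓ 0ℓ
  setoid = record { isEquivalence = ≈-isEquivalence }

  module ≈-Reasoning = SetoidReasoning setoid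

  +-cong : ∀ {m n u v} → m ≈ n → u ≈ v → m + u ≈ n + v
  +-cong {m} {n} {u} {v} m≈n u≈v = congruent (begin
    (m + u) % p           ≡⟨ %-distribˡ-+ m u p ⟩
    (m % p + u % p) % p   ≡⟨ cong₂ (λ a b → (a + b) % p) (%-≡ m≈n) (%-≡ u≈v) ⟩
    (n % p + v % p) % p   ≡⟨ %-distribˡ-+ n v p ⟨
    (n + v) % p           ∎)
    where open ≡-Reasoning

  *-cong : ∀ {m n u v} → m ≈ n → u ≈ v → m * u ≈ n * v
  *-cong {m} {n} {u} {v} m≈n u≈v = congruent (begin
    (m * u) % p           ≡⟨ %-distribˡ-* m u p ⟩
    (m % p * (u % p)) % p ≡⟨ cong₂ (λ a b → (a * b) % p) (%-≡ m≈n) (%-≡ u≈v) ⟩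
    (n % p * (v % p)) % p ≡⟨ %-distribˡ-* n v p ⟨
    (n * v) % p           ∎)
    where open ≡-Reasoning

  +-isCommutativeMonoid : IsCommutativeMonoid _≈_ _+_ 0
  +-isCommutativeMonoid = record
    { isMonoid = record
      { isSemigroup = record
        { isMagma = record { isEquivalence = ≈-isEquivalence ; ∙-cong = +-cong }
        ; assoc = λ m n o → ≡⇒≈ (+-assoc m n o)
        }
      ; identity = (λ m → ≡⇒≈ (+-identityˡ m)) , (λ m → ≡⇒≈ (+-identityʳ m))
      }
    ; comm = λ m n → ≡⇒≈ (+-comm m n)
    }

  *-isCommutativeMonoid : IsCommutativeMonoid _≈_ _*_ 1
  *-isCommutativeMonoid = record
    { isMonoid = record
      { isSemigroup = record
        { isMagma = record { isEquivalence = ≈-isEquivalence ; ∙-cong = *-cong }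
        ; assoc = λ m n o → ≡⇒≈ (*-assoc m n o)
        }
      ; identity = (λ m → ≡⇒≈ (*-identityˡ m)) , (λ m → ≡⇒≈ (*-identityʳ m))
      }
    ; comm = λ m n → ≡⇒≈ (*-comm m n)
    }

  commutativeSemiring : CommutativeSemiring 0ℓ 0ℓ
  commutativeSemiring = record
    { isCommutativeSemiring = IsCommutativeSemiringˡ.isCommutativeSemiring record
      { +-isCommutativeMonoid = +-isCommutativeMonoid
      ; *-isCommutativeMonoid = *-isCommutativeMonoid
      ; distribʳ = λ m n o → ≡⇒≈ (*-distribʳ-+ m n o)
      ; zeroˡ = λ m → ≡⇒≈ (*-zeroˡ m)
      }
    }

  0%p≡0 : 0 % p ≡ 0
  0%p≡0 = m<n⇒m%n≡m (>-nonZero⁻¹ p)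

  ∣⇒≈0 : ∀ {n} → p ∣ n → n ≈ 0
  ∣⇒≈0 {n} p∣n = congruent (trans (n∣m⇒m%n≡0 n p p∣n) (sym 0%p≡0))

  ≈0⇒∣ : ∀ {n} → n ≈ 0 → p ∣ n
  ≈0⇒∣ {n} n≈0 = m%n≡0⇒n∣m n p (trans (%-≡ n≈0) 0%p≡0)

  -- Adding (p - 1) k undoes adding k, since k + (p - 1) k = k p ≈ 0.
  +-cancelʳ-≈ : ∀ {m n} k → m + k ≈ n + k → m ≈ n
  +-cancelʳ-≈ {m} {n} k m+k≈n+k = begin
    m                     ≈⟨ congruent ([m+kn]%n≡m%n m k p) ⟨
    m + k * p             ≡⟨ shift m ⟩
    m + k + k * pred p    ≈⟨ +-cong m+k≈n+k ≈-refl ⟩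
    n + k + k * pred p    ≡⟨ shift n ⟨
    n + k * p             ≈⟨ congruent ([m+kn]%n≡m%n n k p) ⟩
    n                     ∎
    where
    open ≈-Reasoning
    shift : ∀ m → m + k * p ≡ m + k + k * pred p
    shift m = trans (cong (λ q → m + k * q) (sym (suc-pred p)))
                    (trans (cong (m +_) (*-suc k (pred p))) (sym (+-assoc m k (k * pred p))))

module Divisors where

  open import Data.Nat using (_<_; _^_; nonTrivial⇒≢1)
  open import Data.Nat.Properties using (<⇒≢)
  open import Data.Nat.Divisibility using (m∣m*n; ∣-trans; 0∣⇒≡0; ∣1⇒≡1)
  open import Data.Nat.Primality using (euclidsLemma; prime⇒nonTrivial)
  open import Data.Nat.Primality.Factorisation using (factorise)
  open import Data.List.Base using ([]; _∷_)
  open import Data.List.Relation.Unary.All using (_∷_)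
  open import Data.Sum.Base using (inj₁; inj₂)
  open import Data.Empty using (⊥)
  open ≡ using (refl; sym; subst)

  prime-divisor : ∀ n .{{_ : NonZero n}} → ¬ n ≡ 1 → ∃ λ p → Prime p × p ∣ n
  prime-divisor n n≢1 with factorise n
  ... | record { factors = [] ; isFactorisation = n≡1 } = ⊥-elim (n≢1 n≡1)
  ... | record { factors = q ∷ qs ; isFactorisation = n≡q*∏qs ; factorsPrime = q-prime ∷ _ } =
    q , q-prime , subst (q ∣_) (sym n≡q*∏qs) (m∣m*n _)

  no-common-prime-divisor⇒coprime : ∀ {m n} → 0 < m → (∀ {p} → Prime p → p ∣ m → p ∣ n → ⊥) →
                                    Coprime m n
  no-common-prime-divisor⇒coprime 0<m _ {zero} (0∣m , _) = ⊥-elim (<⇒≢ 0<m (sym (0∣⇒≡0 0∣m)))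
  no-common-prime-divisor⇒coprime _ _ {suc zero} _ = refl
  no-common-prime-divisor⇒coprime _ no-prime {d@(suc (suc _))} (d∣m , d∣n)
    with p , p-prime , p∣d ← prime-divisor d (λ ()) =
    ⊥-elim (no-prime p-prime (∣-trans p∣d d∣m) (∣-trans p∣d d∣n))

  prime∣^⇒∣ : ∀ {p m} e → Prime p → p ∣ m ^ e → p ∣ m
  prime∣^⇒∣ zero p-prime p∣1 = ⊥-elim (nonTrivial⇒≢1 {{prime⇒nonTrivial p-prime}} (∣1⇒≡1 p∣1))
  prime∣^⇒∣ {m = m} (suc e) p-prime p∣m^[1+e] with euclidsLemma m (m ^ e) p-prime p∣m^[1+e]
  ... | inj₁ p∣m   = p∣m
  ... | inj₂ p∣m^e = prime∣^⇒∣ e p-prime p∣m^e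

module Matrices {r ℓ} (R : CommutativeSemiring r ℓ) where

  open CommutativeSemiring R
  open import Algebra.Properties.Semiring.Sum semiring
  open import Algebra.Solver.CommutativeMonoid +-commutativeMonoid using (solve; _⊜_; _⊕_)
  open import Relation.Binary.Bundles using (Setoid)
  import Relation.Binary.Reasoning.Setoid as SetoidReasoning

  Matrix : ℕ → ℕ → Set r
  Matrix m n = Fin m → Fin n → Carrier

  -- A record, so that A ≐ B determines A and B during type inference.
  infix 4 _≐_
  record _≐_ {m n} (A B : Matrix m n) : Set ℓ where
    constructor entrywise
    field
      at : ∀ i j → A i j ≈ B i j

  open _≐_ public

  infixl 7 _·_
  infixl 6 _⊞_

  _·_ : ∀ {l m n} → Matrix l m → Matrix m n → Matrix l n
  (A · B) i k = sum (λ j → A i j * B j k)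

  _⊞_ : ∀ {m n} → Matrix m n → Matrix m n → Matrix m n
  (A ⊞ B) i j = A i j + B i j

  J : ∀ {m n} → Matrix m n
  J _ _ = 1#

  _ᵀ : ∀ {m n} → Matrix m n → Matrix n m
  (A ᵀ) i j = A j i

  trace : ∀ {n} → Matrix n n → Carrier
  trace A = sum (λ i → A i i)

  ≐-refl : ∀ {m n} {A : Matrix m n} → A ≐ A
  ≐-refl = entrywise λ _ _ → refl

  ≐-sym : ∀ {m n} {A B : Matrix m n} → A ≐ B → B ≐ A
  ≐-sym A≐B = entrywise λ i j → sym (at A≐B i j)

  ≐-trans : ∀ {m n} {A B C : Matrix m n} → A ≐ B → B ≐ C → A ≐ C
  ≐-trans A≐B B≐C = entrywise λ i j → trans (at A≐B i j) (at B≐C i j)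

  ≐-setoid : ℕ → ℕ → Setoid r ℓ
  ≐-setoid m n = record
    { Carrier = Matrix m n
    ; _≈_ = _≐_
    ; isEquivalence = record { refl = ≐-refl ; sym = ≐-sym ; trans = ≐-trans }
    }

  module ≐-Reasoning {m n} = SetoidReasoning (≐-setoid m n)

  ᵀ-cong : ∀ {m n} {A B : Matrix m n} → A ≐ B → A ᵀ ≐ B ᵀ
  ᵀ-cong A≐B = entrywise λ i j → at A≐B j i

  ·-cong : ∀ {l m n} {A A′ : Matrix l m} {B B′ : Matrix m n} → A ≐ A′ → B ≐ B′ → A · B ≐ A′ · B′
  ·-cong A≐A′ B≐B′ = entrywise λ i k → sum-cong-≋ (λ j → *-cong (at A≐A′ i j) (at B≐B′ j k))

  ·-congˡ : ∀ {l m n} (A : Matrix l m) {B B′ : Matrix m n} → B ≐ B′ → A · B ≐ A · B′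
  ·-congˡ A = ·-cong (≐-refl {A = A})

  ·-congʳ : ∀ {l m n} (B : Matrix m n) {A A′ : Matrix l m} → A ≐ A′ → A · B ≐ A′ · B
  ·-congʳ B A≐A′ = ·-cong A≐A′ (≐-refl {A = B})

  ·-assoc : ∀ {k l m n} (A : Matrix k l) (B : Matrix l m) (C : Matrix m n) →
            (A · B) · C ≐ A · (B · C)
  ·-assoc A B C = entrywise λ i l → let open SetoidReasoning setoid in begin
    sum (λ k → sum (λ j → A i j * B j k) * C k l)
      ≈⟨ sum-cong-≋ (λ k → *-distribʳ-sum (C k l) (λ j → A i j * B j k)) ⟩
    sum (λ k → sum (λ j → A i j * B j k * C k l))
      ≈⟨ ∑-comm (λ k j → A i j * B j k * C k l) ⟩
    sum (λ j → sum (λ k → A i j * B j k * C k l))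
      ≈⟨ sum-cong-≋ (λ j → sum-cong-≋ (λ k → *-assoc (A i j) (B j k) (C k l))) ⟩
    sum (λ j → sum (λ k → A i j * (B j k * C k l)))
      ≈⟨ sum-cong-≋ (λ j → *-distribˡ-sum (A i j) (λ k → B j k * C k l)) ⟨
    sum (λ j → A i j * sum (λ k → B j k * C k l))
      ∎

  ·-distribˡ-⊞ : ∀ {l m n} (A : Matrix l m) (B C : Matrix m n) → A · (B ⊞ C) ≐ A · B ⊞ A · C
  ·-distribˡ-⊞ A B C = entrywise λ i k →
    trans (sum-cong-≋ (λ j → distribˡ (A i j) (B j k) (C j k)))
          (∑-distrib-+ (λ j → A i j * B j k) (λ j → A i j * C j k))

  ·-distribʳ-⊞ : ∀ {l m n} (A B : Matrix l m) (C : Matrix m n) → (A ⊞ B) · C ≐ A · C ⊞ B · C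
  ·-distribʳ-⊞ A B C = entrywise λ i k →
    trans (sum-cong-≋ (λ j → distribʳ (C j k) (A i j) (B i j)))
          (∑-distrib-+ (λ j → A i j * C j k) (λ j → B i j * C j k))

  ᵀ-· : ∀ {l m n} (A : Matrix l m) (B : Matrix m n) → (A · B) ᵀ ≐ B ᵀ · A ᵀ
  ᵀ-· A B = entrywise λ k i → sum-cong-≋ (λ j → *-comm (A i j) (B j k))

  -- In a ring this is (J - C)² = J² - C J - J C + C².
  square-of-complement : ∀ {n} (O C : Matrix n n) → O ⊞ C ≐ J →
                         O · O ⊞ (C · J ⊞ J · C) ≐ J {n = n} · J ⊞ C · C
  square-of-complement {n} O C O⊞C≐J = entrywise entry
    where
    J≐O⊞C : J ≐ O ⊞ C
    J≐O⊞C = ≐-sym O⊞C≐J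
    ·J : ∀ X → X · J ≐ X · O ⊞ X · C
    ·J X = ≐-trans (·-congˡ X J≐O⊞C) (·-distribˡ-⊞ X O C)
    J·C : J · C ≐ O · C ⊞ C · C
    J·C = ≐-trans (·-congʳ C J≐O⊞C) (·-distribʳ-⊞ O C C)
    J·J : J {n = n} · J ≐ (O · O ⊞ O · C) ⊞ (C · O ⊞ C · C)
    J·J = ≐-trans (·-congʳ J J≐O⊞C)
            (≐-trans (·-distribʳ-⊞ O C J) (entrywise λ i j → +-cong (at (·J O) i j) (at (·J C) i j)))
    entry : ∀ i j → (O · O ⊞ (C · J ⊞ J · C)) i j ≈ (J {n = n} · J ⊞ C · C) i j
    entry i j = begin
      a + ((C · J) i j + (J · C) i j)  ≈⟨ +-congˡ (+-cong (at (·J C) i j) (at J·C i j)) ⟩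
      a + ((c + d) + (b + d))          ≈⟨ solve 4 (λ a b c d → a ⊕ ((c ⊕ d) ⊕ (b ⊕ d)) ⊜ ((a ⊕ b) ⊕ (c ⊕ d)) ⊕ d)
                                                refl a b c d ⟩
      ((a + b) + (c + d)) + d          ≈⟨ +-congʳ (at J·J i j) ⟨
      (J {n = n} · J) i j + d          ∎
      where
      open SetoidReasoning setoid
      a = (O · O) i j
      b = (O · C) i j
      c = (C · O) i j
      d = (C · C) i j

module Counting where

  open import Data.Nat using (_+_; _*_)
  open import Data.Nat.Properties using (+-*-semiring)
  open import Algebra.Properties.Semiring.Sum +-*-semiring using (sum; sum-cong-≗) public
  open import Data.Fin.Properties using (0≢1+n; suc-injective)
  open import Relation.Nullary using (Dec; ¬?; _×-dec_)
  open ≡ using (refl; sym; cong)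

  𝟙[_] : ∀ {a} {P : Set a} → Dec P → ℕ
  𝟙[ yes _ ] = 1
  𝟙[ no _ ]  = 0

  𝟙-⇔ : ∀ {a b} {P : Set a} {Q : Set b} (P? : Dec P) (Q? : Dec Q) →
        (P → Q) → (Q → P) → 𝟙[ P? ] ≡ 𝟙[ Q? ]
  𝟙-⇔ (yes _) (yes _) _ _ = refl
  𝟙-⇔ (yes p) (no ¬q) f _ = ⊥-elim (¬q (f p))
  𝟙-⇔ (no ¬p) (yes q) _ g = ⊥-elim (¬p (g q))
  𝟙-⇔ (no _)  (no _)  _ _ = refl

  𝟙-true : ∀ {a} {P : Set a} (P? : Dec P) → P → 𝟙[ P? ] ≡ 1
  𝟙-true (yes _) _ = refl
  𝟙-true (no ¬p) p = ⊥-elim (¬p p)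

  𝟙-× : ∀ {a b} {P : Set a} {Q : Set b} (P? : Dec P) (Q? : Dec Q) →
        𝟙[ P? ] * 𝟙[ Q? ] ≡ 𝟙[ P? ×-dec Q? ]
  𝟙-× (yes _) (yes _) = refl
  𝟙-× (yes _) (no _)  = refl
  𝟙-× (no _)  _       = refl

  𝟙-¬ : ∀ {a} {P : Set a} (P? : Dec P) → 𝟙[ ¬? P? ] + 𝟙[ P? ] ≡ 1
  𝟙-¬ (yes _) = refl
  𝟙-¬ (no _)  = refl

  count≡∑𝟙 : ∀ {n} {P : Fin n → Set} (P? : ∀ i → Dec (P i)) → count P? ≡ sum (λ i → 𝟙[ P? i ])
  count≡∑𝟙 {zero} P? = refl
  count≡∑𝟙 {suc n} P? with P? zero
  ... | yes _ = cong suc (count≡∑𝟙 (λ i → P? (suc i)))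
  ... | no _  = count≡∑𝟙 (λ i → P? (suc i))

  count≡suc⇒∃ : ∀ {n} {P : Fin n → Set} (P? : ∀ i → Dec (P i)) {k} → count P? ≡ suc k → ∃ P
  count≡suc⇒∃ {zero} P? ()
  count≡suc⇒∃ {suc n} P? count≡suc with P? zero
  ... | yes p = zero , p
  ... | no _  = let (i , q) = count≡suc⇒∃ (λ i → P? (suc i)) count≡suc in suc i , q

  ∑𝟙-none : ∀ {n} {P : Fin n → Set} (P? : ∀ i → Dec (P i)) →
            (∀ i → ¬ P i) → sum (λ i → 𝟙[ P? i ]) ≡ 0
  ∑𝟙-none {zero} P? none = refl
  ∑𝟙-none {suc n} P? none with P? zero
  ... | yes p = ⊥-elim (none zero p)
  ... | no _  = ∑𝟙-none (λ i → P? (suc i)) (λ i → none (suc i))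

  ∑𝟙-unique : ∀ {n} {P : Fin n → Set} (P? : ∀ i → Dec (P i)) (i₀ : Fin n) → P i₀ →
              (∀ i → P i → i ≡ i₀) → sum (λ i → 𝟙[ P? i ]) ≡ 1
  ∑𝟙-unique {suc n} P? zero p unique with P? zero
  ... | yes _ = cong suc (∑𝟙-none (λ i → P? (suc i)) (λ i q → 0≢1+n (sym (unique (suc i) q))))
  ... | no ¬p = ⊥-elim (¬p p)
  ∑𝟙-unique {suc n} P? (suc i₀) p unique with P? zero
  ... | yes p₀ with () ← unique zero p₀
  ... | no _  = ∑𝟙-unique (λ i → P? (suc i)) i₀ p (λ i q → suc-injective (unique (suc i) q))

  ∑-const : ∀ n x → sum {n} (λ _ → x) ≡ n * x
  ∑-const zero x = refl
  ∑-const (suc n) x = cong (x +_) (∑-const n x)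

module Rotation where

  open import Level using (Level)
  open import Data.Nat using (_+_; _*_; _∸_; _%_; _/_)
  open import Data.Nat.Properties using (+-comm; m∸n+n≡m)
  open import Data.Nat.DivMod using (m≡m%n+[m/n]*n; m%n≤n)
  open import Data.Nat.GeneralisedArithmetic using (fold; fold-+)
  open import Data.Vec.Base using (Vec; []; _∷_; _∷ʳ_; replicate; toList)
  open import Data.Vec.Properties using (toList-injective; toList-∷ʳ; length-toList; cast-is-id; ∷-injective)
  open import Data.List.Base as List using (List; length; _++_)
  import Data.List.Properties as List
  open ≡ using (refl; sym; trans; cong; subst; module ≡-Reasoning)

  private
    variable
      a : Level
      A : Set a
      m : ℕ

  rotate : Vec A m → Vec A m
  rotate [] = []
  rotate (x ∷ xs) = xs ∷ʳ x

  rotate^ : ℕ → Vec A m → Vec A m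
  rotate^ j xs = fold xs rotate j

  rotate^-+ : ∀ i j (xs : Vec A m) → rotate^ (i + j) xs ≡ rotate^ i (rotate^ j xs)
  rotate^-+ i j xs = fold-+ xs rotate i

  rotate^-suc′ : ∀ j (xs : Vec A m) → rotate^ (suc j) xs ≡ rotate^ j (rotate xs)
  rotate^-suc′ j xs = trans (cong (λ k → rotate^ k xs) (+-comm 1 j)) (rotate^-+ j 1 xs)

  toList-rotate^ : ∀ (ys zs : List A) (xs : Vec A m) → toList xs ≡ ys ++ zs →
                   toList (rotate^ (length ys) xs) ≡ zs ++ ys
  toList-rotate^ List.[] zs xs xs≡zs = trans xs≡zs (sym (List.++-identityʳ zs))
  toList-rotate^ (y List.∷ ys) zs (x ∷ xs) x∷xs≡ with refl , xs≡ ← List.∷-injective x∷xs≡ = begin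
    toList (rotate^ (suc (length ys)) (x ∷ xs))  ≡⟨ cong toList (rotate^-suc′ (length ys) (x ∷ xs)) ⟩
    toList (rotate^ (length ys) (xs ∷ʳ x))       ≡⟨ toList-rotate^ ys (zs ++ List.[ x ]) (xs ∷ʳ x) xs∷ʳx≡ ⟩
    (zs ++ List.[ x ]) ++ ys                     ≡⟨ List.++-assoc zs List.[ x ] ys ⟩
    zs ++ (x List.∷ ys)                          ∎
    where
    open ≡-Reasoning
    xs∷ʳx≡ : toList (xs ∷ʳ x) ≡ ys ++ (zs ++ List.[ x ])
    xs∷ʳx≡ = trans (toList-∷ʳ x xs) (trans (cong (_++ List.[ x ]) xs≡) (List.++-assoc ys zs List.[ x ]))

  rotate^-length : (xs : Vec A m) → rotate^ m xs ≡ xs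
  rotate^-length {m = m} xs = trans (sym (cast-is-id refl (rotate^ m xs)))
    (toList-injective refl (rotate^ m xs) xs
      (subst (λ k → toList (rotate^ k xs) ≡ toList xs) (length-toList xs)
        (toList-rotate^ (toList xs) List.[] xs (sym (List.++-identityʳ (toList xs))))))

  rotate^-* : ∀ x {d} (xs : Vec A m) → rotate^ d xs ≡ xs → rotate^ (x * d) xs ≡ xs
  rotate^-* zero xs _ = refl
  rotate^-* (suc x) {d} xs period =
    trans (rotate^-+ d (x * d) xs) (trans (cong (rotate^ d) (rotate^-* x xs period)) period)

  rotate^-∸ : ∀ i j (xs : Vec A m) → rotate^ (i + j) xs ≡ xs → rotate^ j xs ≡ xs → rotate^ i xs ≡ xs
  rotate^-∸ i j xs i+j-period j-period =
    trans (cong (rotate^ i) (sym j-period)) (trans (sym (rotate^-+ i j xs)) i+j-period)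

  rotate^-fixed : ∀ j {xs : Vec A m} → rotate xs ≡ xs → rotate^ j xs ≡ xs
  rotate^-fixed zero fixed = refl
  rotate^-fixed (suc j) fixed = trans (cong rotate (rotate^-fixed j fixed)) fixed

  rotate-fixed⇒replicate : ∀ x (xs : Vec A m) → rotate (x ∷ xs) ≡ x ∷ xs → xs ≡ replicate m x
  rotate-fixed⇒replicate x [] _ = refl
  rotate-fixed⇒replicate x (y ∷ xs) fixed with refl , fixed′ ← ∷-injective fixed =
    cong (x ∷_) (rotate-fixed⇒replicate x xs fixed′)

  module _ {n : ℕ} .{{_ : NonZero n}} where

    rotate^-% : ∀ j (xs : Vec A n) → rotate^ j xs ≡ rotate^ (j % n) xs
    rotate^-% j xs = begin
      rotate^ j xs                                ≡⟨ cong (λ e → rotate^ e xs) (m≡m%n+[m/n]*n j n) ⟩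
      rotate^ (j % n + (j / n) * n) xs            ≡⟨ rotate^-+ (j % n) ((j / n) * n) xs ⟩
      rotate^ (j % n) (rotate^ ((j / n) * n) xs)  ≡⟨ cong (rotate^ (j % n)) (rotate^-* (j / n) xs (rotate^-length xs)) ⟩
      rotate^ (j % n) xs                          ∎
      where open ≡-Reasoning

    rotate^-inverse : ∀ j (xs : Vec A n) → rotate^ (n ∸ j % n) (rotate^ j xs) ≡ xs
    rotate^-inverse j xs = begin
      rotate^ (n ∸ j % n) (rotate^ j xs)          ≡⟨ cong (rotate^ (n ∸ j % n)) (rotate^-% j xs) ⟩
      rotate^ (n ∸ j % n) (rotate^ (j % n) xs)    ≡⟨ rotate^-+ (n ∸ j % n) (j % n) xs ⟨
      rotate^ (n ∸ j % n + j % n) xs              ≡⟨ cong (λ e → rotate^ e xs) (m∸n+n≡m (m%n≤n j n)) ⟩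
      rotate^ n xs                                ≡⟨ rotate^-length xs ⟩
      xs                                          ∎
      where open ≡-Reasoning

    rotate^-fixed⁻¹ : ∀ j (xs : Vec A n) → rotate (rotate^ j xs) ≡ rotate^ j xs → rotate xs ≡ xs
    rotate^-fixed⁻¹ j xs fixed = subst (λ ys → rotate ys ≡ ys) rotate^[j]≡xs fixed
      where
      rotate^[j]≡xs : rotate^ j xs ≡ xs
      rotate^[j]≡xs = trans (sym (rotate^-fixed (n ∸ j % n) fixed)) (rotate^-inverse j xs)

module WordSums {r ℓ} (R : CommutativeSemiring r ℓ) where

  open import Data.Vec.Base using (Vec; []; _∷_; _∷ʳ_)
  open CommutativeSemiring R
  open import Algebra.Properties.Semiring.Sum semiring
  open Rotation using (rotate; rotate^)

  ∑ᵂ : ∀ {n} m → (Vec (Fin n) m → Carrier) → Carrier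
  ∑ᵂ zero f = f []
  ∑ᵂ (suc m) f = sum (λ a → ∑ᵂ m (λ w → f (a ∷ w)))

  ∑ᵂ-cong : ∀ {n} m {f g : Vec (Fin n) m → Carrier} → (∀ w → f w ≈ g w) → ∑ᵂ m f ≈ ∑ᵂ m g
  ∑ᵂ-cong zero f≈g = f≈g []
  ∑ᵂ-cong (suc m) f≈g = sum-cong-≋ (λ a → ∑ᵂ-cong m (λ w → f≈g (a ∷ w)))

  ∑ᵂ-distrib-+ : ∀ {n} m (f g : Vec (Fin n) m → Carrier) → ∑ᵂ m (λ w → f w + g w) ≈ ∑ᵂ m f + ∑ᵂ m g
  ∑ᵂ-distrib-+ zero f g = refl
  ∑ᵂ-distrib-+ (suc m) f g =
    trans (sum-cong-≋ (λ a → ∑ᵂ-distrib-+ m (λ w → f (a ∷ w)) (λ w → g (a ∷ w))))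
          (∑-distrib-+ (λ a → ∑ᵂ m (λ w → f (a ∷ w))) (λ a → ∑ᵂ m (λ w → g (a ∷ w))))

  *-distribˡ-∑ᵂ : ∀ {n} m x (f : Vec (Fin n) m → Carrier) → x * ∑ᵂ m f ≈ ∑ᵂ m (λ w → x * f w)
  *-distribˡ-∑ᵂ zero x f = refl
  *-distribˡ-∑ᵂ (suc m) x f = trans (*-distribˡ-sum x (λ a → ∑ᵂ m (λ w → f (a ∷ w))))
                                    (sum-cong-≋ (λ a → *-distribˡ-∑ᵂ m x (λ w → f (a ∷ w))))

  ∑-∑ᵂ-comm : ∀ {n k} m (f : Fin k → Vec (Fin n) m → Carrier) →
              sum (λ i → ∑ᵂ m (f i)) ≈ ∑ᵂ m (λ w → sum (λ i → f i w))
  ∑-∑ᵂ-comm zero f = refl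
  ∑-∑ᵂ-comm (suc m) f = trans (∑-comm (λ i a → ∑ᵂ m (λ w → f i (a ∷ w))))
                              (sum-cong-≋ (λ a → ∑-∑ᵂ-comm m (λ i w → f i (a ∷ w))))

  ∑ᵂ-∷ʳ : ∀ {n} m (f : Vec (Fin n) (suc m) → Carrier) →
          ∑ᵂ (suc m) f ≈ sum (λ a → ∑ᵂ m (λ w → f (w ∷ʳ a)))
  ∑ᵂ-∷ʳ zero f = refl
  ∑ᵂ-∷ʳ (suc m) f = trans (sum-cong-≋ (λ b → ∑ᵂ-∷ʳ m (λ w → f (b ∷ w))))
                          (∑-comm (λ b a → ∑ᵂ m (λ w → f (b ∷ (w ∷ʳ a)))))

  ∑ᵂ-rotate : ∀ {n} m (f : Vec (Fin n) m → Carrier) → ∑ᵂ m (λ w → f (rotate w)) ≈ ∑ᵂ m f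
  ∑ᵂ-rotate zero f = refl
  ∑ᵂ-rotate (suc m) f = sym (∑ᵂ-∷ʳ m f)

  ∑ᵂ-rotate^ : ∀ {n} m j (f : Vec (Fin n) m → Carrier) → ∑ᵂ m (λ w → f (rotate^ j w)) ≈ ∑ᵂ m f
  ∑ᵂ-rotate^ m zero f = refl
  ∑ᵂ-rotate^ m (suc j) f = trans (∑ᵂ-rotate^ m j (λ w → f (rotate w))) (∑ᵂ-rotate m f)

module Necklace {p : ℕ} (p-prime : Prime p) where

  open import Level using (Level)
  open import Data.Nat using (_+_; _*_; _∸_; _<_; _≤_; _%_; >-nonZero⁻¹)
  open import Data.Nat.Properties
    using (+-assoc; *-identityʳ; *-identityˡ; *-distribʳ-+; <⇒≤; ≤-total; m≤n⇒m<n∨m≡n; m<n⇒0<n∸m;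
           m∸n≤m; ≤-<-trans; m∸n+n≡m)
  open import Data.Nat.DivMod using (m%n<n)
  open import Data.Nat.Divisibility using (m∣m*n)
  open import Data.Nat.Coprimality using (coprime-Bézout; prime⇒coprime)
  open import Data.Nat.Primality using (prime⇒nonZero)
  open import Data.Nat.GCD using (module Bézout)
  open import Data.Fin.Base using (toℕ; fromℕ<)
  open import Data.Fin.Properties as Fin using (toℕ-fromℕ<; toℕ<n; toℕ-injective; all?)
  open import Data.Vec.Base using (Vec)
  open import Data.Vec.Properties using (≡-dec)
  open import Data.Vec.Relation.Binary.Pointwise.Inductive using (Pointwise-≡⇒≡)
  import Data.Vec.Relation.Binary.Lex.NonStrict as Lex
  open import Data.List.Base using (allFin)
  import Data.List.Relation.Unary.All as All
  open import Data.List.Membership.Propositional.Properties using (∈-allFin)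
  open import Data.Sum.Base using (inj₁; inj₂)
  open import Relation.Nullary using (Dec; ¬?)
  open import Relation.Binary.Bundles using (DecTotalOrder)
  open ≡ using (refl; sym; trans; cong; cong₂; subst; module ≡-Reasoning)
  import Algebra.Properties.Semiring.Sum as Sum

  instance
    _ = prime⇒nonZero p-prime

  open Modulo p
  open WordSums commutativeSemiring
  open Rotation
  open Counting
  module Modular = Sum (CommutativeSemiring.semiring commutativeSemiring)

  private
    variable
      a : Level
      A : Set a

  Fixed : Vec A p → Set _
  Fixed w = rotate w ≡ w

  -- The periods of w form a subgroup of ℤ containing p and d, hence (Bézout) also 1.
  period⇒fixed : ∀ {d} (w : Vec A p) → 0 < d → d < p → rotate^ d w ≡ w → Fixed w
  period⇒fixed {d = d@(suc _)} w _ d<p period with coprime-Bézout (prime⇒coprime p-prime d<p)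
  ... | Bézout.+- x y 1+yd≡xp = rotate^-∸ 1 (y * d) w
          (subst (λ e → rotate^ e w ≡ w) (sym 1+yd≡xp) (rotate^-* x w (rotate^-length w)))
          (rotate^-* y w period)
  ... | Bézout.-+ x y 1+xp≡yd = rotate^-∸ 1 (x * p) w
          (subst (λ e → rotate^ e w ≡ w) (sym 1+xp≡yd) (rotate^-* y w period))
          (rotate^-* x w (rotate^-length w))

  rotate^-injective-≤ : ∀ {w : Vec A p} → ¬ Fixed w → ∀ {i j} → i ≤ j → j < p →
                        rotate^ i w ≡ rotate^ j w → i ≡ j
  rotate^-injective-≤ {w = w} ¬fixed {i} {j} i≤j j<p rotations≡ with m≤n⇒m<n∨m≡n i≤j
  ... | inj₂ i≡j = i≡j
  ... | inj₁ i<j = ⊥-elim (¬fixed (rotate^-fixed⁻¹ i w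
          (period⇒fixed (rotate^ i w) (m<n⇒0<n∸m i<j) (≤-<-trans (m∸n≤m j i) j<p) period)))
    where
    period : rotate^ (j ∸ i) (rotate^ i w) ≡ rotate^ i w
    period = trans (sym (rotate^-+ (j ∸ i) i w))
                   (trans (cong (λ e → rotate^ e w) (m∸n+n≡m i≤j)) (sym rotations≡))

  rotate^-injective : ∀ {w : Vec A p} → ¬ Fixed w → ∀ {i j} → i < p → j < p →
                      rotate^ i w ≡ rotate^ j w → i ≡ j
  rotate^-injective ¬fixed {i} {j} i<p j<p rotations≡ with ≤-total i j
  ... | inj₁ i≤j = rotate^-injective-≤ ¬fixed i≤j j<p rotations≡
  ... | inj₂ j≤i = sym (rotate^-injective-≤ ¬fixed j≤i i<p (sym rotations≡))

  module _ {n : ℕ} where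

    lexOrder : DecTotalOrder _ _ _
    lexOrder = Lex.≤-decTotalOrder (Fin.≤-decTotalOrder n) p

    open DecTotalOrder lexOrder using (antisym; totalOrder) renaming (_≤_ to _≼_; _≤?_ to _≼?_)
    open import Data.List.Extrema totalOrder using (argmin; f[argmin]≤f[xs])

    Minimal : Vec (Fin n) p → Set
    Minimal w = ∀ (j : Fin p) → w ≼ rotate^ (toℕ j) w

    minimal? : ∀ w → Dec (Minimal w)
    minimal? w = all? (λ j → w ≼? rotate^ (toℕ j) w)

    minimal⇒≼rotate^ : ∀ {w} → Minimal w → ∀ m → w ≼ rotate^ m w
    minimal⇒≼rotate^ {w} minimal m =
      subst (w ≼_) (sym (trans (rotate^-% m w) rotate^[m%p])) (minimal (fromℕ< (m%n<n m p)))
      where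
      rotate^[m%p] : rotate^ (m % p) w ≡ rotate^ (toℕ (fromℕ< (m%n<n m p))) w
      rotate^[m%p] = cong (λ e → rotate^ e w) (sym (toℕ-fromℕ< (m%n<n m p)))

    minimal-unique : ∀ {u v} → Minimal u → Minimal v → ∀ m → v ≡ rotate^ m u → u ≡ v
    minimal-unique {u} {v} minimal-u minimal-v m v≡ = Pointwise-≡⇒≡ (antisym u≼v v≼u)
      where
      u≼v : u ≼ v
      u≼v = subst (u ≼_) (sym v≡) (minimal⇒≼rotate^ minimal-u m)
      v≼u : v ≼ u
      v≼u = subst (v ≼_) (trans (cong (rotate^ (p ∸ m % p)) v≡) (rotate^-inverse m u))
                  (minimal⇒≼rotate^ minimal-v (p ∸ m % p))

    minimal-rotation : ∀ w → Σ (Fin p) λ j → Minimal (rotate^ (toℕ j) w)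
    minimal-rotation w = j₀ , minimal
      where
      f : Fin p → Vec (Fin n) p
      f j = rotate^ (toℕ j) w
      j₀ : Fin p
      j₀ = argmin f (fromℕ< (>-nonZero⁻¹ p)) (allFin p)
      minimal : Minimal (f j₀)
      minimal i = subst (f j₀ ≼_) f[j]≡
        (All.lookup (f[argmin]≤f[xs] {f = f} (fromℕ< (>-nonZero⁻¹ p)) (allFin p)) (∈-allFin j))
        where
        m = toℕ i + toℕ j₀
        j = fromℕ< (m%n<n m p)
        f[j]≡ : f j ≡ rotate^ (toℕ i) (f j₀)
        f[j]≡ = trans (cong (λ e → rotate^ e w) (toℕ-fromℕ< (m%n<n m p)))
                      (trans (sym (rotate^-% m w)) (rotate^-+ (toℕ i) (toℕ j₀) w))

    unique-minimal-rotation : ∀ {w} → ¬ Fixed w →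
                              sum (λ (j : Fin p) → 𝟙[ minimal? (rotate^ (toℕ j) w) ]) ≡ 1
    unique-minimal-rotation {w} ¬fixed with j₀ , minimal₀ ← minimal-rotation w =
      ∑𝟙-unique (λ (j : Fin p) → minimal? (rotate^ (toℕ j) w)) j₀ minimal₀ unique
      where
      unique : ∀ j → Minimal (rotate^ (toℕ j) w) → j ≡ j₀
      unique j minimal = toℕ-injective (rotate^-injective ¬fixed (toℕ<n j) (toℕ<n j₀)
        (sym (minimal-unique minimal₀ minimal (toℕ j + (p ∸ toℕ j₀)) (sym back))))
        where
        back : rotate^ (toℕ j + (p ∸ toℕ j₀)) (rotate^ (toℕ j₀) w) ≡ rotate^ (toℕ j) w
        back = begin
          rotate^ (toℕ j + (p ∸ toℕ j₀)) (rotate^ (toℕ j₀) w)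
            ≡⟨ rotate^-+ (toℕ j + (p ∸ toℕ j₀)) (toℕ j₀) w ⟨
          rotate^ (toℕ j + (p ∸ toℕ j₀) + toℕ j₀) w
            ≡⟨ cong (λ e → rotate^ e w) (+-assoc (toℕ j) (p ∸ toℕ j₀) (toℕ j₀)) ⟩
          rotate^ (toℕ j + (p ∸ toℕ j₀ + toℕ j₀)) w
            ≡⟨ cong (λ e → rotate^ (toℕ j + e) w) (m∸n+n≡m (<⇒≤ (toℕ<n j₀))) ⟩
          rotate^ (toℕ j + p) w
            ≡⟨ rotate^-+ (toℕ j) p w ⟩
          rotate^ (toℕ j) (rotate^ p w)
            ≡⟨ cong (rotate^ (toℕ j)) (rotate^-length w) ⟩
          rotate^ (toℕ j) w
            ∎
          where open ≡-Reasoning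

    fixed? : (w : Vec (Fin n) p) → Dec (Fixed w)
    fixed? w = ≡-dec Fin._≟_ (rotate w) w

    RotationInvariant : (Vec (Fin n) p → ℕ) → Set
    RotationInvariant f = ∀ w → f (rotate w) ≡ f w

    rotate^-invariant : ∀ {f} → RotationInvariant f → ∀ j w → f (rotate^ j w) ≡ f w
    rotate^-invariant invariant zero w = refl
    rotate^-invariant invariant (suc j) w = trans (invariant (rotate^ j w)) (rotate^-invariant invariant j w)

    -- A non-fixed word has p distinct rotations, exactly one of them minimal; so the sum
    -- over non-fixed words is p times the sum over the minimal ones.
    ∑ᵂ-nonfixed≈0 : ∀ f → RotationInvariant f → ∑ᵂ p (λ w → 𝟙[ ¬? (fixed? w) ] * f w) ≈ 0
    ∑ᵂ-nonfixed≈0 f invariant = begin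
      ∑ᵂ p F                                                    ≈⟨ ∑ᵂ-cong p orbit-sum ⟩
      ∑ᵂ p (λ w → sum (λ (j : Fin p) → G (rotate^ (toℕ j) w)))
        ≈⟨ ∑-∑ᵂ-comm p (λ (j : Fin p) w → G (rotate^ (toℕ j) w)) ⟨
      sum (λ (j : Fin p) → ∑ᵂ p (λ w → G (rotate^ (toℕ j) w)))
        ≈⟨ Modular.sum-cong-≋ (λ (j : Fin p) → ∑ᵂ-rotate^ p (toℕ j) G) ⟩
      sum (λ (j : Fin p) → ∑ᵂ p G)                              ≡⟨ ∑-const p (∑ᵂ p G) ⟩
      p * ∑ᵂ p G                                                ≈⟨ ∣⇒≈0 (m∣m*n (∑ᵂ p G)) ⟩
      0                                                         ∎
      where
      open ≈-Reasoning
      F G : Vec (Fin n) p → ℕ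
      F w = 𝟙[ ¬? (fixed? w) ] * f w
      G w = F w * 𝟙[ minimal? w ]
      F-invariant : ∀ j w → F (rotate^ j w) ≡ F w
      F-invariant j w = cong₂ _*_
        (𝟙-⇔ (¬? (fixed? (rotate^ j w))) (¬? (fixed? w))
          (λ ¬fixed fixed → ¬fixed (subst Fixed (sym (rotate^-fixed j fixed)) fixed))
          (λ ¬fixed fixed → ¬fixed (rotate^-fixed⁻¹ j w fixed)))
        (rotate^-invariant invariant j w)
      minimal-rotations : Vec (Fin n) p → ℕ
      minimal-rotations w = sum (λ (j : Fin p) → 𝟙[ minimal? (rotate^ (toℕ j) w) ])
      F*minimal-rotations≡F : ∀ w → F w * minimal-rotations w ≡ F w
      F*minimal-rotations≡F w with fixed? w
      ... | yes _     = refl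
      ... | no ¬fixed = trans (cong (1 * f w *_) (unique-minimal-rotation ¬fixed)) (*-identityʳ (1 * f w))
      orbit-sum : ∀ w → F w ≈ sum (λ (j : Fin p) → G (rotate^ (toℕ j) w))
      orbit-sum w = begin
        F w                                                             ≡⟨ F*minimal-rotations≡F w ⟨
        F w * minimal-rotations w
          ≈⟨ Modular.*-distribˡ-sum (F w) (λ (j : Fin p) → 𝟙[ minimal? (rotate^ (toℕ j) w) ]) ⟩
        sum (λ (j : Fin p) → F w * 𝟙[ minimal? (rotate^ (toℕ j) w) ])
          ≡⟨ sum-cong-≗ (λ (j : Fin p) → cong (_* 𝟙[ minimal? (rotate^ (toℕ j) w) ]) (sym (F-invariant (toℕ j) w))) ⟩
        sum (λ (j : Fin p) → G (rotate^ (toℕ j) w))                     ∎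

    ∑ᵂ-cong-fixed : ∀ f g → RotationInvariant f → RotationInvariant g →
                    (∀ w → Fixed w → f w ≡ g w) → ∑ᵂ p f ≈ ∑ᵂ p g
    ∑ᵂ-cong-fixed f g f-invariant g-invariant f≡g = begin
      ∑ᵂ p f                              ≈⟨ fixed-part f f-invariant ⟩
      ∑ᵂ p (λ w → 𝟙[ fixed? w ] * f w)    ≈⟨ ∑ᵂ-cong p (λ w → ≡⇒≈ (agree w)) ⟩
      ∑ᵂ p (λ w → 𝟙[ fixed? w ] * g w)    ≈⟨ fixed-part g g-invariant ⟨
      ∑ᵂ p g                              ∎
      where
      open ≈-Reasoning
      agree : ∀ w → 𝟙[ fixed? w ] * f w ≡ 𝟙[ fixed? w ] * g w
      agree w with fixed? w
      ... | yes fixed = cong (1 *_) (f≡g w fixed)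
      ... | no _      = refl
      fixed-part : ∀ h → RotationInvariant h → ∑ᵂ p h ≈ ∑ᵂ p (λ w → 𝟙[ fixed? w ] * h w)
      fixed-part h invariant = begin
        ∑ᵂ p h
          ≈⟨ ∑ᵂ-cong p (λ w → ≡⇒≈ (split w)) ⟩
        ∑ᵂ p (λ w → 𝟙[ ¬? (fixed? w) ] * h w + 𝟙[ fixed? w ] * h w)
          ≈⟨ ∑ᵂ-distrib-+ p _ _ ⟩
        ∑ᵂ p (λ w → 𝟙[ ¬? (fixed? w) ] * h w) + ∑ᵂ p (λ w → 𝟙[ fixed? w ] * h w)
          ≈⟨ +-cong (∑ᵂ-nonfixed≈0 h invariant) ≈-refl ⟩
        ∑ᵂ p (λ w → 𝟙[ fixed? w ] * h w)
          ∎
        where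
        split : ∀ w → h w ≡ 𝟙[ ¬? (fixed? w) ] * h w + 𝟙[ fixed? w ] * h w
        split w = trans (sym (*-identityˡ (h w)))
          (trans (cong (_* h w) (sym (𝟙-¬ (fixed? w)))) (*-distribʳ-+ (h w) 𝟙[ ¬? (fixed? w) ] 𝟙[ fixed? w ]))

module SquareZero {k : ℕ} (p-prime : Prime (suc k)) where

  open import Data.Nat using (_+_; _*_; _^_)
  open import Data.Nat.Properties using (*-comm; *-assoc; *-identityʳ; +-identityʳ)
  open import Data.Nat.Primality using (¬prime[1])
  open import Data.Vec.Base using (Vec; []; _∷_; _∷ʳ_; replicate)
  open ≡ using (refl; cong) renaming (sym to ≡-sym; trans to ≡-trans)
  import Algebra.Properties.Semiring.Sum as Sum

  p : ℕ
  p = suc k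

  open Modulo p
  open CommutativeSemiring commutativeSemiring using (sym; trans; zeroʳ; *-congˡ)
  open Matrices commutativeSemiring
  open WordSums commutativeSemiring
  open Sum (CommutativeSemiring.semiring commutativeSemiring)
    using (sum; sum-cong-≋; sum-replicate-zero; *-distribʳ-sum)
  open Rotation
  open Necklace p-prime using (∑ᵂ-cong-fixed)
  open Divisors using (prime∣^⇒∣)

  module _ {n : ℕ} (Y : Matrix n n) where

    walk : ∀ {m} → Fin n → Vec (Fin n) m → Fin n → ℕ
    walk a [] c = Y a c
    walk a (b ∷ w) c = Y a b * walk b w c

    walks : ℕ → Matrix n n
    walks m a c = ∑ᵂ m (λ w → walk a w c)

    cycle : ∀ {m} → Vec (Fin n) (suc m) → ℕ
    cycle (a ∷ w) = walk a w a

    diagonal : ∀ {m} → Vec (Fin n) m → ℕ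
    diagonal [] = 1
    diagonal (a ∷ w) = Y a a * diagonal w

    walks-suc : ∀ m → walks (suc m) ≐ Y · walks m
    walks-suc m = entrywise λ a c →
      sym (sum-cong-≋ (λ (b : Fin n) → *-distribˡ-∑ᵂ m (Y a b) (λ w → walk b w c)))

    walks≈0 : (∀ a c → (Y · Y) a c ≈ 0) → ∀ m a c → walks (suc m) a c ≈ 0
    walks≈0 Y²≈0 zero a c = trans (at (walks-suc 0) a c) (Y²≈0 a c)
    walks≈0 Y²≈0 (suc m) a c = trans (at (walks-suc (suc m)) a c)
      (trans (sum-cong-≋ (λ (b : Fin n) → trans (*-congˡ {Y a b} (walks≈0 Y²≈0 m b c)) (zeroʳ (Y a b))))
             (sum-replicate-zero n))

    ∑ᵂ-diagonal : ∀ m → ∑ᵂ m diagonal ≈ trace Y ^ m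
    ∑ᵂ-diagonal zero = ≈-refl
    ∑ᵂ-diagonal (suc m) =
      trans (sum-cong-≋ (λ (a : Fin n) → trans (sym (*-distribˡ-∑ᵂ m (Y a a) diagonal))
                                               (*-congˡ {Y a a} (∑ᵂ-diagonal m))))
            (sym (*-distribʳ-sum (trace Y ^ m) (λ (a : Fin n) → Y a a)))

    walk-∷ʳ : ∀ {m} b (w : Vec (Fin n) m) a c → walk b (w ∷ʳ a) c ≡ walk b w a * Y a c
    walk-∷ʳ b [] a c = refl
    walk-∷ʳ b (x ∷ w) a c = ≡-trans (cong (Y b x *_) (walk-∷ʳ x w a c)) (≡-sym (*-assoc (Y b x) _ _))

    diagonal-∷ʳ : ∀ {m} (w : Vec (Fin n) m) a → diagonal (w ∷ʳ a) ≡ diagonal w * Y a a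
    diagonal-∷ʳ [] a = ≡-trans (*-identityʳ (Y a a)) (≡-sym (+-identityʳ (Y a a)))
    diagonal-∷ʳ (x ∷ w) a = ≡-trans (cong (Y x x *_) (diagonal-∷ʳ w a)) (≡-sym (*-assoc (Y x x) _ _))

    cycle-rotate : ∀ {m} (w : Vec (Fin n) (suc m)) → cycle (rotate w) ≡ cycle w
    cycle-rotate (a ∷ []) = refl
    cycle-rotate (a ∷ b ∷ w) = ≡-trans (walk-∷ʳ b w a b) (*-comm (walk b w a) (Y a b))

    diagonal-rotate : ∀ {m} (w : Vec (Fin n) m) → diagonal (rotate w) ≡ diagonal w
    diagonal-rotate [] = refl
    diagonal-rotate (a ∷ w) = ≡-trans (diagonal-∷ʳ w a) (*-comm (diagonal w) (Y a a))

    walk-replicate : ∀ m a → walk a (replicate m a) a ≡ diagonal (a ∷ replicate m a)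
    walk-replicate zero a = ≡-sym (*-identityʳ (Y a a))
    walk-replicate (suc m) a = cong (Y a a *_) (walk-replicate m a)

    cycle-fixed : ∀ {m} (w : Vec (Fin n) (suc m)) → rotate w ≡ w → cycle w ≡ diagonal w
    cycle-fixed {m} (a ∷ w) fixed with refl ← rotate-fixed⇒replicate a w fixed = walk-replicate m a

    -- trace Y ^ p sums the diagonal products and trace (Y ^ p) the closed walks over all
    -- words of length p; both summands are rotation invariant and agree on constant words.
    trace-square-zero : (∀ a c → (Y · Y) a c ≈ 0) → p ∣ trace Y
    trace-square-zero Y²≈0 = prime∣^⇒∣ p p-prime (≈0⇒∣ (begin
      trace Y ^ p              ≈⟨ ∑ᵂ-diagonal p ⟨
      ∑ᵂ p diagonal            ≈⟨ ∑ᵂ-cong-fixed diagonal cycle diagonal-rotate cycle-rotate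
                                    (λ w fixed → ≡-sym (cycle-fixed w fixed)) ⟩
      ∑ᵂ p cycle               ≈⟨ sum-cong-≋ (closed-walks≈0 p-prime) ⟩
      sum (λ (_ : Fin n) → 0)  ≈⟨ sum-replicate-zero n ⟩
      0                        ∎))
      where
      open ≈-Reasoning
      closed-walks≈0 : ∀ {m} → Prime (suc m) → ∀ a → walks m a a ≈ 0
      closed-walks≈0 {zero} prime[1] _ = ⊥-elim (¬prime[1] prime[1])
      closed-walks≈0 {suc m} _ a = walks≈0 Y²≈0 m a a

module Collineation {G : Geometry} {s t : ℕ} (gq : IsThickGQ G s t) (θ : Automorphism G) where

  open import Data.Nat using (s≤s; z≤n)
  open import Data.Sum.Base using (inj₁; inj₂)
  open import Function.Bundles using (Inverse)
  open Geometry G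
  open IsThickGQ gq
  open Counting using (count≡suc⇒∃)
  open ≡ using (refl; sym; trans; subst)

  θ⁻¹ : Fin np → Fin np
  θ⁻¹ = Inverse.from (onPoints θ)

  θ∘θ⁻¹ : ∀ x → pt θ (θ⁻¹ x) ≡ x
  θ∘θ⁻¹ = Inverse.strictlyInverseˡ (onPoints θ)

  collinear-θ : ∀ {x y} → Collinear G x y → Collinear G (pt θ x) (pt θ y)
  collinear-θ {x} {y} (L , x∈L , y∈L) = ln θ L , preserves θ x L x∈L , preserves θ y L y∈L

  collinear-θ⁻¹ : ∀ {x y} → Collinear G (pt θ x) (pt θ y) → Collinear G x y
  collinear-θ⁻¹ {x} {y} (L , θx∈L , θy∈L) =
    M , reflects θ x M (subst (pt θ x I_) (sym θM≡L) θx∈L) , reflects θ y M (subst (pt θ y I_) (sym θM≡L) θy∈L)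
    where
    M = Inverse.from (onLines θ) L
    θM≡L : ln θ M ≡ L
    θM≡L = Inverse.strictlyInverseˡ (onLines θ) L

  ¬identity : HasOrder G θ 2 ⊎ HasOrder G θ 3 → ¬ PowIsId G θ 1
  ¬identity (inj₁ (_ , smaller-powers)) = smaller-powers 1 (s≤s z≤n) (s≤s (s≤s z≤n))
  ¬identity (inj₂ (_ , smaller-powers)) = smaller-powers 1 (s≤s z≤n) (s≤s (s≤s z≤n))

  some-point : HasOrder G θ 2 ⊎ HasOrder G θ 3 → Fin np
  some-point order = point-or-identity np refl
    where
    -- Without points there are no lines either, and then θ would be the identity.
    point-or-identity : ∀ n → n ≡ np → Fin np
    point-or-identity (suc n) n≡np = subst Fin n≡np zero
    point-or-identity zero 0≡np =
      ⊥-elim (¬identity order ((λ x → ⊥-elim (no-point x)) , (λ L → ⊥-elim (no-point (point-on L)))))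
      where
      no-point : ¬ Fin np
      no-point x with () ← subst Fin (sym 0≡np) x
      point-on : Fin nl → Fin np
      point-on L = proj₁ (count≡suc⇒∃ (λ x → I? x L) (line-size L))

  -- A line through x and θ x is fixed as soon as it also contains θ² x, which holds for
  -- order 2; for order 3 the alternative contradicts the quadrangle axiom.
  collinear-with-image⇒fixed-line : HasOrder G θ 2 ⊎ HasOrder G θ 3 → (∀ x → ¬ pt θ x ≡ x) →
                                    ∀ x → Collinear G (pt θ x) x → Σ (Fin nl) λ L → ln θ L ≡ L
  collinear-with-image⇒fixed-line (inj₁ ((θ²≡id , _) , _)) no-fixed-point x (L , θx∈L , x∈L) =
    L , sym (at-most-one-line (pt θ x) x (no-fixed-point x) L (ln θ L) θx∈L x∈L
           (preserves θ x L x∈L) (subst (_I ln θ L) (θ²≡id x) (preserves θ (pt θ x) L θx∈L)))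
  collinear-with-image⇒fixed-line (inj₂ ((θ³≡id , _) , _)) no-fixed-point x (L , θx∈L , x∈L)
    with I? (pt θ (pt θ x)) L
  ... | yes θ²x∈L =
    L , sym (at-most-one-line (pt θ x) (pt θ (pt θ x)) (λ θx≡θ²x → no-fixed-point (pt θ x) (sym θx≡θ²x))
           L (ln θ L) θx∈L θ²x∈L (preserves θ x L x∈L) (preserves θ (pt θ x) L θx∈L))
  ... | no θ²x∉L with _ , _ , _ , unique ← gq-axiom (pt θ (pt θ x)) L θ²x∉L =
    ⊥-elim (no-fixed-point x (trans (unique (pt θ x) θx∈L θ²x~θx) (sym (unique x x∈L θ²x~x))))
    where
    θ²x~θx : Collinear G (pt θ (pt θ x)) (pt θ x)
    θ²x~θx = collinear-θ (L , θx∈L , x∈L)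
    θ²x~x : Collinear G (pt θ (pt θ x)) x
    θ²x~x with M , θ³x∈M , θ²x∈M ← collinear-θ θ²x~θx = M , θ²x∈M , subst (_I M) (θ³≡id x) θ³x∈M

module QuadrangleCounting (G : Geometry) {s t : ℕ} (gq : IsThickGQ G s t)
                          (p : ℕ) .{{_ : NonZero p}} (p∣s : p ∣ s) (p∣t : p ∣ t) where

  open import Data.Nat using (_+_; _*_)
  open import Data.Nat.Properties using (*-identityʳ)
  open import Data.Nat.Divisibility using (∣1⇒≡1)
  open import Relation.Nullary using (Dec; ¬?; _×-dec_)
  open Geometry G
  open IsThickGQ gq
  open Modulo p
  open Matrices commutativeSemiring
  open Counting
  open ≡ using (refl) renaming (sym to ≡-sym; trans to ≡-trans; cong to ≡-cong)

  collinear? : ∀ x y → Dec (Collinear G x y)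
  collinear? x y = any? (λ L → I? x L ×-dec I? y L)

  N : Matrix np nl
  N x L = 𝟙[ I? x L ]

  C O : Matrix np np
  C x y = 𝟙[ collinear? x y ]
  O x y = 𝟙[ ¬? (collinear? x y) ]

  suc≈1 : ∀ {n} → p ∣ n → suc n ≈ 1
  suc≈1 p∣n = +-cong {1} ≈-refl (∣⇒≈0 p∣n)

  lines-through : ∀ x → sum (λ L → N x L) ≡ suc t
  lines-through x = ≡-trans (≡-sym (count≡∑𝟙 (I? x))) (point-deg x)

  points-on : ∀ L → sum (λ x → N x L) ≡ suc s
  points-on L = ≡-trans (≡-sym (count≡∑𝟙 (λ x → I? x L))) (line-size L)

  collinear-refl : ∀ x → Collinear G x x
  collinear-refl x = let (L , x∈L) = count≡suc⇒∃ (I? x) (point-deg x) in L , x∈L , x∈L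

  collinear-sym : ∀ {x y} → Collinear G x y → Collinear G y x
  collinear-sym (L , x∈L , y∈L) = L , y∈L , x∈L

  C-sym : ∀ x y → C x y ≡ C y x
  C-sym x y = 𝟙-⇔ (collinear? x y) (collinear? y x) collinear-sym collinear-sym

  common-lines : ∀ {x y} → ¬ x ≡ y → sum (λ L → 𝟙[ I? x L ×-dec I? y L ]) ≡ C x y
  common-lines {x} {y} x≢y with collinear? x y
  ... | yes (L , x∈L , y∈L) = ∑𝟙-unique (λ L → I? x L ×-dec I? y L) L (x∈L , y∈L)
          (λ M (x∈M , y∈M) → at-most-one-line x y x≢y M L x∈M y∈M x∈L y∈L)
  ... | no ¬x~y = ∑𝟙-none (λ L → I? x L ×-dec I? y L) (λ L (x∈L , y∈L) → ¬x~y (L , x∈L , y∈L))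

  N·Nᵀ≐C : N · N ᵀ ≐ C
  N·Nᵀ≐C = entrywise entry
    where
    entry : ∀ x y → (N · N ᵀ) x y ≈ C x y
    entry x y with x ≟ y
    ... | no x≢y = ≡⇒≈ (≡-trans (sum-cong-≗ (λ L → 𝟙-× (I? x L) (I? y L))) (common-lines x≢y))
    ... | yes refl = begin
      sum (λ L → N x L * N x L) ≡⟨ sum-cong-≗ (λ L → ≡-trans (𝟙-× (I? x L) (I? x L))
                                     (𝟙-⇔ (I? x L ×-dec I? x L) (I? x L) proj₁ (λ x∈L → x∈L , x∈L))) ⟩
      sum (λ L → N x L)         ≡⟨ lines-through x ⟩
      suc t                     ≈⟨ suc≈1 p∣t ⟩
      1                         ≡⟨ 𝟙-true (collinear? x x) (collinear-refl x) ⟨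
      C x x                     ∎
      where open ≈-Reasoning

  -- Entry (L, y) counts the points of L collinear with y: all s + 1 of them if y is on L,
  -- and exactly one otherwise by the quadrangle axiom.
  Nᵀ·C≐J : N ᵀ · C ≐ J
  Nᵀ·C≐J = entrywise entry
    where
    entry : ∀ L y → (N ᵀ · C) L y ≈ 1
    entry L y with I? y L
    ... | yes y∈L = begin
      sum (λ x → N x L * C x y) ≡⟨ sum-cong-≗ (λ x → ≡-trans (𝟙-× (I? x L) (collinear? x y))
                                     (𝟙-⇔ (I? x L ×-dec collinear? x y) (I? x L) proj₁ (λ x∈L → x∈L , L , x∈L , y∈L))) ⟩
      sum (λ x → N x L)         ≡⟨ points-on L ⟩
      suc s                     ≈⟨ suc≈1 p∣s ⟩
      1                         ∎
      where open ≈-Reasoning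
    ... | no y∉L with q , q∈L , y~q , unique ← gq-axiom y L y∉L =
      ≡⇒≈ (≡-trans (sum-cong-≗ (λ x → 𝟙-× (I? x L) (collinear? x y)))
                   (∑𝟙-unique (λ x → I? x L ×-dec collinear? x y) q (q∈L , collinear-sym y~q)
                      (λ x (x∈L , x~y) → unique x x∈L (collinear-sym x~y))))

  N·J≐J : N · J ≐ J {n = np}
  N·J≐J = entrywise λ x _ → let open ≈-Reasoning in begin
    sum (λ L → N x L * 1) ≡⟨ sum-cong-≗ (λ L → *-identityʳ (N x L)) ⟩
    sum (λ L → N x L)     ≡⟨ lines-through x ⟩
    suc t                 ≈⟨ suc≈1 p∣t ⟩
    1                     ∎

  Nᵀ·J≐J : N ᵀ · J ≐ J {n = np}
  Nᵀ·J≐J = entrywise λ L _ → let open ≈-Reasoning in begin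
    sum (λ x → N x L * 1) ≡⟨ sum-cong-≗ (λ x → *-identityʳ (N x L)) ⟩
    sum (λ x → N x L)     ≡⟨ points-on L ⟩
    suc s                 ≈⟨ suc≈1 p∣s ⟩
    1                     ∎

  C·J≐J : C · J ≐ J {n = np}
  C·J≐J = begin
    C · J           ≈⟨ ·-congʳ J (≐-sym N·Nᵀ≐C) ⟩
    N · N ᵀ · J     ≈⟨ ·-assoc N (N ᵀ) J ⟩
    N · (N ᵀ · J)   ≈⟨ ·-congˡ N Nᵀ·J≐J ⟩
    N · J           ≈⟨ N·J≐J ⟩
    J               ∎
    where open ≐-Reasoning

  C·C≐J : C · C ≐ J
  C·C≐J = begin
    C · C           ≈⟨ ·-congʳ C (≐-sym N·Nᵀ≐C) ⟩
    N · N ᵀ · C     ≈⟨ ·-assoc N (N ᵀ) C ⟩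
    N · (N ᵀ · C)   ≈⟨ ·-congˡ N Nᵀ·C≐J ⟩
    N · J           ≈⟨ N·J≐J ⟩
    J               ∎
    where open ≐-Reasoning

  J·C≐J : J {n = np} · C ≐ J
  J·C≐J = begin
    J · C           ≈⟨ ·-congˡ J (entrywise λ x y → ≡⇒≈ (C-sym x y)) ⟩
    J · C ᵀ         ≈⟨ ᵀ-· C J ⟨
    (C · J) ᵀ       ≈⟨ ᵀ-cong C·J≐J ⟩
    J               ∎
    where open ≐-Reasoning

  J·J≐J : J {n = np} · J ≐ J {n = np}
  J·J≐J = begin
    J {n = np} · J  ≈⟨ ·-congʳ J (≐-sym C·C≐J) ⟩
    C · C · J       ≈⟨ ·-assoc C C J ⟩
    C · (C · J)     ≈⟨ ·-congˡ C C·J≐J ⟩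
    C · J           ≈⟨ C·J≐J ⟩
    J               ∎
    where open ≐-Reasoning

  O·O≈0 : ∀ x y → (O · O) x y ≈ 0
  O·O≈0 x y = +-cancelʳ-≈ 2 (begin
    (O · O) x y + 2                            ≈⟨ +-cong {(O · O) x y} ≈-refl (+-cong (at C·J≐J x y) (at J·C≐J x y)) ⟨
    (O · O) x y + ((C · J) x y + (J · C) x y)  ≈⟨ at (square-of-complement O C O⊞C≐J) x y ⟩
    (J {n = np} · J) x y + (C · C) x y         ≈⟨ +-cong (at J·J≐J x y) (at C·C≐J x y) ⟩
    2                                          ∎)
    where
    open ≈-Reasoning
    O⊞C≐J : O ⊞ C ≐ J
    O⊞C≐J = entrywise λ x y → ≡⇒≈ (𝟙-¬ (collinear? x y))

  points≈1 : Fin np → np ≈ 1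
  points≈1 x = ≈-trans (≡⇒≈ (≡-trans (≡-sym (*-identityʳ np)) (≡-sym (∑-const np 1)))) (at J·J≐J x x)

  ∣points⇒≡1 : Fin np → p ∣ np → p ≡ 1
  ∣points⇒≡1 x p∣np = ∣1⇒≡1 (≈0⇒∣ (≈-trans (≈-sym (points≈1 x)) (∣⇒≈0 p∣np)))

  module _ (θ : Automorphism G) where

    open Collineation gq θ using (θ⁻¹; θ∘θ⁻¹; collinear-θ; collinear-θ⁻¹)

    O-θ : ∀ x y → O (pt θ x) (pt θ y) ≡ O x y
    O-θ x y = 𝟙-⇔ (¬? (collinear? (pt θ x) (pt θ y))) (¬? (collinear? x y))
                  (λ ¬θx~θy x~y → ¬θx~θy (collinear-θ x~y)) (λ ¬x~y θx~θy → ¬x~y (collinear-θ⁻¹ θx~θy))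

    Y : Matrix np np
    Y x y = O (pt θ x) y

    Y·Y≈0 : ∀ x z → (Y · Y) x z ≈ 0
    Y·Y≈0 x z = ≈-trans (≡⇒≈ (sum-cong-≗ (λ y → ≡-cong (O (pt θ x) y *_) O[θy,z])))
                        (O·O≈0 (pt θ x) (θ⁻¹ z))
      where
      O[θy,z] : ∀ {y} → O (pt θ y) z ≡ O y (θ⁻¹ z)
      O[θy,z] {y} = ≡-trans (≡-cong (O (pt θ y)) (≡-sym (θ∘θ⁻¹ z))) (O-θ y (θ⁻¹ z))

    trace-Y : (∀ x → ¬ Collinear G (pt θ x) x) → trace Y ≡ np
    trace-Y not-collinear =
      ≡-trans (sum-cong-≗ (λ x → 𝟙-true (¬? (collinear? (pt θ x) x)) (not-collinear x)))
              (≡-trans (∑-const np 1) (*-identityʳ np))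

module _ {G : Geometry} {s t : ℕ} (gq : IsThickGQ G s t) (θ : Automorphism G) where

  open import Data.Nat using (nonTrivial⇒≢1)
  open import Data.Nat.Primality using (prime⇒nonTrivial; ¬prime[0])
  open import Data.Empty using (⊥)
  open ≡ using (subst)
  open Geometry G

  no-common-prime-divisor : Fin np → (∀ x → ¬ Collinear G (pt θ x) x) →
                            ∀ {p} → Prime p → p ∣ s → p ∣ t → ⊥
  no-common-prime-divisor _ _ {zero} p-prime _ _ = ¬prime[0] p-prime
  no-common-prime-divisor x₀ not-collinear {p@(suc _)} p-prime p∣s p∣t =
    nonTrivial⇒≢1 {{prime⇒nonTrivial p-prime}} (∣points⇒≡1 x₀ p∣np)
    where
    open QuadrangleCounting G gq p p∣s p∣t
    open SquareZero p-prime using (trace-square-zero)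
    p∣np : p ∣ np
    p∣np = subst (p ∣_) (trace-Y θ not-collinear) (trace-square-zero (Y θ) (Y·Y≈0 θ))

lemma3p4 : (G : Geometry) (s t : ℕ) → IsThickGQ G s t →
           (θ : Automorphism G) → HasOrder G θ 2 ⊎ HasOrder G θ 3 →
           ((p : Fin (Geometry.np G)) → ¬ pt θ p ≡ p) →
           ¬ Coprime s t →
           Σ (Fin (Geometry.nl G)) λ L → ln θ L ≡ L
lemma3p4 G s t gq θ order no-fixed-point ¬coprime with any? (λ L → ln θ L ≟ L)
... | yes fixed-line = fixed-line
... | no no-fixed-line =
  ⊥-elim (¬coprime (no-common-prime-divisor⇒coprime (≤-trans (s≤s z≤n) s≥2)
    (no-common-prime-divisor gq θ (some-point order) not-collinear)))
  where
  open IsThickGQ gq using (s≥2)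
  open Collineation gq θ using (some-point; collinear-with-image⇒fixed-line)
  open Divisors using (no-common-prime-divisor⇒coprime)
  not-collinear : ∀ x → ¬ Collinear G (pt θ x) x
  not-collinear x x~θx = no-fixed-line (collinear-with-image⇒fixed-line order no-fixed-point x x~θx)
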